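{- Let $(G_1,\sigma_1,\prec_1)$ and $(G_2,\sigma_2,\prec_2)$ be admissible UPO-graphs such that $G_1$ has $n$ output edges $o_1\prec_1\cdots\prec_1 o_n$ and $G_2$ has $n$ input edges $i_1\prec_2\cdots\prec_2 i_n$, and let $(G,\sigma)=G_2\circ G_1$ with composed linear order $\prec=\prec_2\circ\prec_1$. Then for every inner vertex $v$ of $(G,\sigma)$, $I(G)\cap\overline{O(v)}=\emptyset$ and $O(G)\cap\overline{I(v)}=\emptyset$, where convex hulls are taken in $(E(G),\prec)$.
   Context: Directed graphs are finite, may have multiple edges, and each edge $e$ has source $s(e)$ and target $t(e)$. $I(v)$, $O(v)$ denote the incoming and outgoing edges of a vertex $v$, and $E(v)=I(v)\cup O(v)$. $e_1\to e_2$ means there is a directed path starting with edge $e_1$ and ending with edge $e_2$. For a subset $X$ of a finite linearly ordered set, $\overline{X}$ is the set of elements between $\min X$ and $\max X$ inclusive. An upward planar order on a finite acyclic directed graph $G$ is a linear order $\prec$ on $E(G)$ such that (i) $e_1\to e_2$ implies $e_1\prec e_2$; (ii) for every vertex $v$, $\overline{I(v)}\cap\overline{O(v)}=\emptyset$ and $\overline{E(v)}=\overline{I(v)}\sqcup\overline{O(v)}$; (iii) for any vertices $v_1,v_2$, $I(v_1)\cap\overline{I(v_2)}\neq\emptyset$ implies $\overline{I(v_1)}\subseteq\overline{I(v_2)}$, and $O(v_1)\cap\overline{O(v_2)}\neq\emptyset$ implies $\overline{O(v_1)}\subseteq\overline{O(v_2)}$. A progressive graph $(G,\sigma)$ is a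 finite acyclic directed graph $G$ with a distinguished subset $\sigma$ of vertices of degree one (boundary vertices); the other vertices are inner vertices. Boundary sources are input vertices, boundary sinks are output vertices. Edges starting at a boundary vertex are input edges, forming $I(G)$; edges ending at a boundary vertex are output edges, forming $O(G)$. An upward planar order $\prec$ on $(G,\sigma)$ is admissible if for every inner vertex $v$, $I(G)\cap\overline{O(v)}=\emptyset$ and $O(G)\cap\overline{I(v)}=\emptyset$; $(G,\sigma,\prec)$ is then an admissible UPO-graph. Composition: given $(G_1,\sigma_1,\prec_1)$ with output edges $o_1\prec_1\cdots\prec_1 o_n$ and $(G_2,\sigma_2,\prec_2)$ with input edges $i_1\prec_2\cdots\prec_2 i_n$, the graph $G=G_2\circ G_1$ is obtained by deleting the output vertices of $G_1$ and the input vertices of $G_2$ and, for each $k$, replacing $o_k$ and $i_k$ by a single edge $\overline{e_k}$ with source $s(o_k)$ and target $t(i_k)$; its boundary $\sigma$ consists of the input vertices of $G_1$ and the output vertices of $G_2$. Write $(E(G_1),\prec_1)$ as the consecutive blocks $Q_1,\{o_1\},Q_2,\{o_2\},\dots,Q_n,\{o_n\},Q_{n+1}$ (so $Q_1$ is the set of edges before $o_1$, $Q_k$ those strictly between $o_{k-1}$ and $o_k$, $Q_{n+1}$ those after $o_n$), and $(E(G_2),\prec_2)$ as $P_0,\{i_1\},P_1,\dots,\{i_n\},P_n$ similarly. The composed order $\prec=\prec_2\circ\prec_1$ on $E(G)$ is the linear order whose consecutive blocks are $P_0,Q_1,\{\overline{e_1}\},P_1,Q_2,\{\overline{e_2}\},P_2,\dots,Q_n,\{\overline{e_n}\},P_n,Q_{n+1}$,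 with each $Q_k$ ordered by $\prec_1$ and each $P_k$ by $\prec_2$. -}

module Defs where

open import Data.Nat using (ℕ)
open import Data.Fin using (Fin; _<_; _≤_)
open import Data.Bool using (Bool; T)
open import Data.List using (List; []; _∷_; _++_; [_]; length; lookup; zip; map; concat; allFin; filterᵇ)
open import Data.Product using (Σ; ∃; _×_; _,_; proj₁; proj₂)
open import Data.Sum using (_⊎_; inj₁; inj₂)
open import Relation.Nullary using (¬_; yes; no)
open import Relation.Nullary.Decidable using (T?)
open import Relation.Binary.PropositionalEquality using (_≡_; _≢_; refl)
open import Function.Bundles using (_↔_)

-- The edge set is Fin m (m = number of
-- edges) and the linear order on edges is the order of positions in the
-- list 'edges' (i.e. the usual order on Fin m); the k-th entry of the
-- list is (source , target) of the k-th edge.  σ is the set of boundary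
-- vertices (as a Boolean predicate).

record PGraph : Set₁ where
  field
    V     : Set
    edges : List (V × V)
    σ     : V → Bool

open PGraph public

Edge : PGraph → Set
Edge G = Fin (length (edges G))

src tgt : (G : PGraph) → Edge G → V G
src G e = proj₁ (lookup (edges G) e)
tgt G e = proj₂ (lookup (edges G) e)

_⊢_≺_ : (G : PGraph) → Edge G → Edge G → Set
G ⊢ e₁ ≺ e₂ = e₁ < e₂

In Out Inc : (G : PGraph) → V G → Edge G → Set
In  G v e = tgt G e ≡ v
Out G v e = src G e ≡ v
Inc G v e = In G v e ⊎ Out G v e

Hull : (G : PGraph) → (Edge G → Set) → Edge G → Set
Hull G X e = ∃ λ a → ∃ λ b → X a × X b × a ≤ e × e ≤ b

data Path (G : PGraph) : Edge G → Edge G → Set where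
  step : ∀ {e₁ e₂} → tgt G e₁ ≡ src G e₂ → Path G e₁ e₂
  _▸_  : ∀ {e₁ e₂ e₃} → Path G e₁ e₂ → tgt G e₂ ≡ src G e₃ → Path G e₁ e₃

-- no directed cycle (a loop counts as a cycle)
Acyclic : PGraph → Set
Acyclic G = ∀ e → ¬ Path G e e

DegreeOne : (G : PGraph) → V G → Set
DegreeOne G v =
  ∃ λ e → Inc G v e × ¬ (In G v e × Out G v e) × (∀ e′ → Inc G v e′ → e′ ≡ e)

FiniteV : PGraph → Set
FiniteV G = Σ ℕ λ k → V G ↔ Fin k

record IsProgressive (G : PGraph) : Set where
  field
    acyclic     : Acyclic G
    boundaryDeg : ∀ v → T (σ G v) → DegreeOne G v

Inner : (G : PGraph) → V G → Set
Inner G v = ¬ T (σ G v)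

InputEdge OutputEdge : (G : PGraph) → Edge G → Set
InputEdge  G e = T (σ G (src G e))
OutputEdge G e = T (σ G (tgt G e))

IsInputVertex IsOutputVertex : (G : PGraph) → V G → Set
IsInputVertex  G v = T (σ G v) × (∀ e → tgt G e ≢ v)
IsOutputVertex G v = T (σ G v) × (∀ e → src G e ≢ v)

record IsUPO (G : PGraph) : Set where
  field
    monotone : ∀ {e₁ e₂} → Path G e₁ e₂ → G ⊢ e₁ ≺ e₂
    disjoint : ∀ v e → Hull G (In G v) e → ¬ Hull G (Out G v) e
    cover    : ∀ v e → Hull G (Inc G v) e → Hull G (In G v) e ⊎ Hull G (Out G v) e
    nestIn   : ∀ v₁ v₂ → (∃ λ e → In G v₁ e × Hull G (In G v₂) e) →
               ∀ e → Hull G (In G v₁) e → Hull G (In G v₂) e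
    nestOut  : ∀ v₁ v₂ → (∃ λ e → Out G v₁ e × Hull G (Out G v₂) e) →
               ∀ e → Hull G (Out G v₁) e → Hull G (Out G v₂) e

AdmissibleCond : PGraph → Set
AdmissibleCond G =
  ∀ v → Inner G v →
    (∀ e → InputEdge G e → ¬ Hull G (Out G v) e) ×
    (∀ e → OutputEdge G e → ¬ Hull G (In G v) e)

numInputEdges numOutputEdges : PGraph → ℕ
numInputEdges  G = length (filterᵇ (λ e → σ G (src G e)) (allFin _))
numOutputEdges G = length (filterᵇ (λ e → σ G (tgt G e)) (allFin _))

-- Splitting a list at the elements satisfying p:
--   x₁ … (blocks B₁, separator s₁, B₂, s₂, …, Bₙ, sₙ, tail)
-- returns ([(B₁,s₁),…,(Bₙ,sₙ)] , tail).

Seg : (A : Set) → (A → Bool) → Set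
Seg A p = List (Σ A (λ a → ¬ T (p a))) × Σ A (λ a → T (p a))

splitBy : {A : Set} (p : A → Bool) → List A →
          List (Seg A p) × List (Σ A (λ a → ¬ T (p a)))
splitBy p [] = [] , []
splitBy p (a ∷ as) with T? (p a) | splitBy p as
... | yes pa  | segs , tl = ([] , (a , pa)) ∷ segs , tl
... | no  ¬pa | [] , tl = [] , (a , ¬pa) ∷ tl
... | no  ¬pa | (blk , sep) ∷ segs , tl = ((a , ¬pa) ∷ blk , sep) ∷ segs , tl

module Composition (G₁ G₂ : PGraph) where

  CV : Set
  CV = Σ (V G₁) (λ v → ¬ IsOutputVertex G₁ v) ⊎ Σ (V G₂) (λ v → ¬ IsInputVertex G₂ v)

  Cσ : CV → Bool
  Cσ (inj₁ (v , _)) = σ G₁ v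
  Cσ (inj₂ (v , _)) = σ G₂ v

  isOut₁ : Edge G₁ → Bool
  isOut₁ e = σ G₁ (tgt G₁ e)

  isIn₂ : Edge G₂ → Bool
  isIn₂ e = σ G₂ (src G₂ e)

  edge₁ : Σ (Edge G₁) (λ e → ¬ T (isOut₁ e)) → CV × CV
  edge₁ (e , ne) = inj₁ (src G₁ e , λ x → proj₂ x e refl)
                 , inj₁ (tgt G₁ e , λ x → ne (proj₁ x))

  edge₂ : Σ (Edge G₂) (λ e → ¬ T (isIn₂ e)) → CV × CV
  edge₂ (e , ne) = inj₂ (src G₂ e , λ x → ne (proj₁ x))
                 , inj₂ (tgt G₂ e , λ x → proj₂ x e refl)

  glue : Σ (Edge G₁) (λ e → T (isOut₁ e)) → Σ (Edge G₂) (λ e → T (isIn₂ e)) → CV × CV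
  glue (o , _) (i , _) = inj₁ (src G₁ o , λ x → proj₂ x o refl)
                       , inj₂ (tgt G₂ i , λ x → proj₂ x i refl)

  -- E(G₁) = Q₁ o₁ Q₂ o₂ … Qₙ oₙ Qₙ₊₁
  split₁ = splitBy isOut₁ (allFin _)
  -- E(G₂) = P₀ i₁ P₁ i₂ … Pₙ₋₁ iₙ Pₙ
  split₂ = splitBy isIn₂ (allFin _)

  piece : Seg (Edge G₂) isIn₂ × Seg (Edge G₁) isOut₁ → List (CV × CV)
  piece ((P , i) , (Q , o)) = map edge₂ P ++ map edge₁ Q ++ [ glue o i ]

  -- P₀ Q₁ ē₁ P₁ Q₂ ē₂ … Pₙ₋₁ Qₙ ēₙ Pₙ Qₙ₊₁
  Cedges : List (CV × CV)
  Cedges = concat (map piece (zip (proj₁ split₂) (proj₁ split₁)))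
           ++ map edge₂ (proj₂ split₂) ++ map edge₁ (proj₂ split₁)

compose : (G₁ G₂ : PGraph) → numOutputEdges G₁ ≡ numInputEdges G₂ → PGraph
compose G₁ G₂ _ = record { V = CV ; edges = Cedges ; σ = Cσ }
  where open Composition G₁ G₂

-- Every edge of G₂ ∘ G₁ is an edge of G₁, an edge of G₂, or a glued edge ēₖ coming from
-- both, and the composed order projects monotonically onto ≺₁ and onto ≺₂: an edge of G₂
-- lying in Pₖ is sent to the gap just after oₖ in ≺₁, an edge of G₁ lying in Qₖ to the gap
-- just before iₖ in ≺₂.  A violation of admissibility at an inner vertex v of G₂ ∘ G₁ thus
-- projects onto the factor containing v, where it becomes a violation of that factor's
-- admissibility: the offending boundary edge is either an edge of that factor, or sits in
-- the gap next to a glued oₖ (resp. iₖ), which is then a boundary edge of the factor in the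
-- same convex hull.
module Submission where

open import Defs
open import Data.Nat using (ℕ; zero; suc; _+_; _≤_; _<_; z≤n; s≤s; s≤s⁻¹)
open import Data.Nat.Properties
  using (≤-refl; ≤-trans; ≤-reflexive; n≤1+n; +-mono-≤; +-monoʳ-≤; ≤⇒≯; n≮0;
         ⌊n/2⌋-mono; n≡⌊n+n/2⌋; n≡⌈n+n/2⌉)
open import Data.Fin using (Fin; toℕ; cast) renaming (zero to fzero; suc to fsuc)
open import Data.Fin.Properties using (toℕ<n; toℕ-cast)
open import Data.Bool using (Bool; T)
open import Data.Maybe using (Maybe; just; nothing)
open import Data.List using (List; []; _∷_; _++_; [_]; length; lookup; zip; map; concat; allFin)
open import Data.List.Properties using (length-map; map-tabulate; map-∘; ++-assoc; ++-identityʳ)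
open import Data.Product using (Σ; _×_; _,_; proj₁; proj₂)
open import Data.Sum using (_⊎_; inj₁; inj₂)
open import Data.Unit using (⊤; tt)
open import Data.Empty using (⊥; ⊥-elim)
open import Function using (_∘_)
open import Relation.Nullary using (¬_; yes; no)
open import Relation.Nullary.Decidable using (T?)
open import Relation.Binary.PropositionalEquality
  using (_≡_; refl; sym; trans; cong; subst; subst₂; module ≡-Reasoning)

-- Positions in a linear order of edges, doubled: at k is the k-th edge, before k the gap
-- just before it.

before at : ℕ → ℕ
before k = k + k
at k = suc (k + k)

before-mono : ∀ {a b} → a ≤ b → before a ≤ before b
before-mono a≤b = +-mono-≤ a≤b a≤b

before≤at : ∀ k → before k ≤ at k
before≤at k = n≤1+n (k + k)

at≤before-suc : ∀ k → at k ≤ before (suc k)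
at≤before-suc k = s≤s (+-monoʳ-≤ k (n≤1+n k))

before≤at⇒≤ : ∀ {a b} → before a ≤ at b → a ≤ b
before≤at⇒≤ {a} {b} h = subst₂ _≤_ (sym (n≡⌊n+n/2⌋ a)) (sym (n≡⌈n+n/2⌉ b)) (⌊n/2⌋-mono h)

at≤at⇒≤ : ∀ {a b} → at a ≤ at b → a ≤ b
at≤at⇒≤ {a} h = before≤at⇒≤ (≤-trans (before≤at a) h)

at≤before⇒< : ∀ {a b} → at a ≤ before b → a < b
at≤before⇒< {a} {b} h =
  subst₂ _≤_ (cong suc (sym (n≡⌊n+n/2⌋ a))) (sym (n≡⌈n+n/2⌉ b)) (⌊n/2⌋-mono (s≤s h))

module _ {A : Set} (f : A → ℕ) where

  AscendingFrom : ℕ → List A → Set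
  AscendingFrom h []       = ⊤
  AscendingFrom h (x ∷ xs) = h ≤ f x × AscendingFrom (f x) xs

  ascending-weaken : ∀ {h h′} xs → h ≤ h′ → AscendingFrom h′ xs → AscendingFrom h xs
  ascending-weaken []       _    _             = tt
  ascending-weaken (x ∷ xs) h≤h′ (h′≤x , asc) = ≤-trans h≤h′ h′≤x , asc

  ascending-lower : ∀ {h} xs → AscendingFrom h xs → (i : Fin (length xs)) → h ≤ f (lookup xs i)
  ascending-lower (x ∷ xs) (h≤x , _)   fzero    = h≤x
  ascending-lower (x ∷ xs) (h≤x , asc) (fsuc i) = ≤-trans h≤x (ascending-lower xs asc i)

  ascending-lookup : ∀ {h} xs → AscendingFrom h xs → {i j : Fin (length xs)} →
                     toℕ i ≤ toℕ j → f (lookup xs i) ≤ f (lookup xs j)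
  ascending-lookup (x ∷ xs) _           {fzero}  {fzero}  _   = ≤-refl
  ascending-lookup (x ∷ xs) (_ , asc)   {fzero}  {fsuc j} _   = ascending-lower xs asc j
  ascending-lookup (x ∷ xs) (_ , asc)   {fsuc i} {fsuc j} i≤j = ascending-lookup xs asc (s≤s⁻¹ i≤j)

  ascending-constant-block : {B : Set} (g : B → A) {c h : ℕ} → (∀ y → f (g y) ≡ c) → h ≤ c →
                             ∀ ys {rest} → AscendingFrom c rest → AscendingFrom h (map g ys ++ rest)
  ascending-constant-block g fg≡c h≤c []       asc = ascending-weaken _ h≤c asc
  ascending-constant-block g fg≡c h≤c (y ∷ ys) asc =
    ≤-trans h≤c (≤-reflexive (sym (fg≡c y))) ,
    ascending-weaken _ (≤-reflexive (fg≡c y)) (ascending-constant-block g fg≡c ≤-refl ys asc)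

StrictlyBetween : {A : Set} → (A → ℕ) → ℕ → List A → ℕ → Set
StrictlyBetween key lb []       ub = lb ≤ ub
StrictlyBetween key lb (x ∷ xs) ub = lb ≤ key x × StrictlyBetween key (suc (key x)) xs ub

module _ {A : Set} (key : A → ℕ) where

  strictlyBetween-≤ : ∀ {lb ub} xs → StrictlyBetween key lb xs ub → lb ≤ ub
  strictlyBetween-≤ []       lb≤ub            = lb≤ub
  strictlyBetween-≤ (x ∷ xs) (lb≤x , between) =
    ≤-trans lb≤x (≤-trans (n≤1+n _) (strictlyBetween-≤ xs between))

  strictlyBetween-weaken : ∀ {lb lb′ ub} xs → lb ≤ lb′ →
                           StrictlyBetween key lb′ xs ub → StrictlyBetween key lb xs ub
  strictlyBetween-weaken []       lb≤lb′ lb′≤ub             = ≤-trans lb≤lb′ lb′≤ub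
  strictlyBetween-weaken (x ∷ xs) lb≤lb′ (lb′≤x , between) = ≤-trans lb≤lb′ lb′≤x , between

  ascending-strict-block : {B : Set} (f : B → ℕ) (g : A → B) → (∀ x → f (g x) ≡ at (key x)) →
                           ∀ {lb ub h} xs {rest} → StrictlyBetween key lb xs ub → h ≤ before lb →
                           AscendingFrom f (before ub) rest → AscendingFrom f h (map g xs ++ rest)
  ascending-strict-block f g fg≡at []       lb≤ub h≤lb asc =
    ascending-weaken f _ (≤-trans h≤lb (before-mono lb≤ub)) asc
  ascending-strict-block f g fg≡at (x ∷ xs) (lb≤x , between) h≤lb asc =
    ≤-trans (≤-trans h≤lb (before-mono lb≤x))
            (≤-trans (before≤at (key x)) (≤-reflexive (sym (fg≡at x)))) ,
    ascending-weaken f _ (≤-reflexive (fg≡at x))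
      (ascending-strict-block f g fg≡at xs between (at≤before-suc (key x)) asc)

strictlyBetween-map-suc : ∀ {n lb ub} (xs : List (Fin n)) → StrictlyBetween toℕ lb xs ub →
                          StrictlyBetween toℕ (suc lb) (map fsuc xs) (suc ub)
strictlyBetween-map-suc []       lb≤ub            = s≤s lb≤ub
strictlyBetween-map-suc (x ∷ xs) (lb≤x , between) = s≤s lb≤x , strictlyBetween-map-suc xs between

allFin-strictlyBetween : ∀ k → StrictlyBetween toℕ 0 (allFin k) k
allFin-strictlyBetween zero    = z≤n
allFin-strictlyBetween (suc k) =
  z≤n , subst (λ xs → StrictlyBetween toℕ 1 xs (suc k)) (map-tabulate (λ i → i) fsuc)
          (strictlyBetween-map-suc (allFin k) (allFin-strictlyBetween k))

idx : {k : ℕ} {P : Fin k → Set} → Σ (Fin k) P → ℕ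
idx = toℕ ∘ proj₁

module _ {k : ℕ} (p : Fin k → Bool) where

  SplitBetween : ℕ → List (Seg (Fin k) p) → List (Σ (Fin k) λ a → ¬ T (p a)) → Set
  SplitBetween lb []                 tl = StrictlyBetween idx lb tl k
  SplitBetween lb ((B , sep) ∷ segs) tl =
    StrictlyBetween idx lb B (idx sep) × SplitBetween (suc (idx sep)) segs tl

  splitBy-between : ∀ {lb} xs → StrictlyBetween toℕ lb xs k →
                    SplitBetween lb (proj₁ (splitBy p xs)) (proj₂ (splitBy p xs))
  splitBy-between []       lb≤k = lb≤k
  splitBy-between (a ∷ as) (lb≤a , between)
    with T? (p a) | splitBy p as | splitBy-between as between
  ... | yes _ | _                   , _ | split              = lb≤a , split
  ... | no  _ | []                  , _ | split              = lb≤a , split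
  ... | no  _ | (_ , _) ∷ _         , _ | (between′ , split) = (lb≤a , between′) , split

  splitBetween-tail : ∀ {lb} segs tl → SplitBetween lb segs tl → StrictlyBetween idx lb tl k
  splitBetween-tail []                 tl between            = between
  splitBetween-tail ((B , sep) ∷ segs) tl (between , split) =
    strictlyBetween-weaken idx tl (≤-trans (strictlyBetween-≤ idx B between) (n≤1+n _))
      (splitBetween-tail segs tl split)

lookup-map : {A B : Set} (f : A → B) (xs : List A) (i : Fin (length (map f xs))) →
             lookup (map f xs) i ≡ f (lookup xs (cast (length-map f xs) i))
lookup-map f (x ∷ xs) fzero    = refl
lookup-map f (x ∷ xs) (fsuc i) = lookup-map f xs i

map-map-++ : {A B C : Set} (f : B → C) (g : A → B) (xs : List A) (ys : List B) →
             map f (map g xs ++ ys) ≡ map (f ∘ g) xs ++ map f ys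
map-map-++ f g []       ys = refl
map-map-++ f g (x ∷ xs) ys = cong (f (g x) ∷_) (map-map-++ f g xs ys)

module Pieces (G₁ G₂ : PGraph) where
  open Composition G₁ G₂

  O₁ K₁ I₂ K₂ : Set
  O₁ = Σ (Edge G₁) (λ e → T (isOut₁ e))
  K₁ = Σ (Edge G₁) (λ e → ¬ T (isOut₁ e))
  I₂ = Σ (Edge G₂) (λ e → T (isIn₂ e))
  K₂ = Σ (Edge G₂) (λ e → ¬ T (isIn₂ e))

  -- An edge of Qₖ is tagged with iₖ (nothing for Qₙ₊₁), an edge of Pₖ with oₖ (nothing
  -- for P₀): the tag locates the edge in the order of the other factor.
  data Piece : Set where
    kept₁ : Maybe I₂ → K₁ → Piece
    kept₂ : Maybe O₁ → K₂ → Piece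
    glued : O₁ → I₂ → Piece

  endpoints : Piece → CV × CV
  endpoints (kept₁ _ e) = edge₁ e
  endpoints (kept₂ _ e) = edge₂ e
  endpoints (glued o i) = glue o i

  source target : Piece → CV
  source = proj₁ ∘ endpoints
  target = proj₂ ∘ endpoints

  tailPieces : Maybe O₁ → List K₂ → List K₁ → List Piece
  tailPieces mo t₂ t₁ = map (kept₂ mo) t₂ ++ map (kept₁ nothing) t₁

  layout : Maybe O₁ → List (Seg (Edge G₂) isIn₂) → List (Seg (Edge G₁) isOut₁) →
           List K₂ → List K₁ → List Piece
  layout mo []      segs₁ t₂ t₁ = tailPieces mo t₂ t₁
  layout mo (_ ∷ _) []    t₂ t₁ = tailPieces mo t₂ t₁
  layout mo ((P , i) ∷ segs₂) ((Q , o) ∷ segs₁) t₂ t₁ =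
    map (kept₂ mo) P ++ map (kept₁ (just i)) Q ++ glued o i ∷ layout (just o) segs₂ segs₁ t₂ t₁

  tailPieces-endpoints : ∀ mo t₂ t₁ →
    map endpoints (tailPieces mo t₂ t₁) ≡ map edge₂ t₂ ++ map edge₁ t₁
  tailPieces-endpoints mo t₂ t₁ =
    trans (map-map-++ endpoints (kept₂ mo) t₂ _) (cong (map edge₂ t₂ ++_) (sym (map-∘ t₁)))

  layout-endpoints : ∀ mo segs₂ segs₁ t₂ t₁ → map endpoints (layout mo segs₂ segs₁ t₂ t₁) ≡
    concat (map piece (zip segs₂ segs₁)) ++ map edge₂ t₂ ++ map edge₁ t₁
  layout-endpoints mo []      segs₁ t₂ t₁ = tailPieces-endpoints mo t₂ t₁
  layout-endpoints mo (_ ∷ _) []    t₂ t₁ = tailPieces-endpoints mo t₂ t₁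
  layout-endpoints mo ((P , i) ∷ segs₂) ((Q , o) ∷ segs₁) t₂ t₁ = begin
    map endpoints (map (kept₂ mo) P ++ map (kept₁ (just i)) Q ++ glued o i ∷ rest)
      ≡⟨ map-map-++ endpoints (kept₂ mo) P _ ⟩
    map edge₂ P ++ map endpoints (map (kept₁ (just i)) Q ++ glued o i ∷ rest)
      ≡⟨ cong (map edge₂ P ++_) (map-map-++ endpoints (kept₁ (just i)) Q _) ⟩
    map edge₂ P ++ map edge₁ Q ++ glue o i ∷ map endpoints rest
      ≡⟨ cong (λ xs → map edge₂ P ++ map edge₁ Q ++ glue o i ∷ xs)
              (layout-endpoints (just o) segs₂ segs₁ t₂ t₁) ⟩
    map edge₂ P ++ map edge₁ Q ++ [ glue o i ] ++ later
      ≡⟨ cong (map edge₂ P ++_) (sym (++-assoc (map edge₁ Q) [ glue o i ] later)) ⟩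
    map edge₂ P ++ (map edge₁ Q ++ [ glue o i ]) ++ later
      ≡⟨ sym (++-assoc (map edge₂ P) _ later) ⟩
    piece ((P , i) , (Q , o)) ++ later
      ≡⟨ sym (++-assoc (piece ((P , i) , (Q , o))) (concat (map piece (zip segs₂ segs₁))) _) ⟩
    concat (map piece (zip ((P , i) ∷ segs₂) ((Q , o) ∷ segs₁))) ++ map edge₂ t₂ ++ map edge₁ t₁ ∎
    where
    open ≡-Reasoning
    rest : List Piece
    rest = layout (just o) segs₂ segs₁ t₂ t₁
    later : List (CV × CV)
    later = concat (map piece (zip segs₂ segs₁)) ++ map edge₂ t₂ ++ map edge₁ t₁

  segments₂ : List (Seg (Edge G₂) isIn₂)
  segments₂ = proj₁ split₂

  segments₁ : List (Seg (Edge G₁) isOut₁)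
  segments₁ = proj₁ split₁

  lastP : List K₂
  lastP = proj₂ split₂

  lastQ : List K₁
  lastQ = proj₂ split₁

  pieces : List Piece
  pieces = layout nothing segments₂ segments₁ lastP lastQ

  pieces-endpoints : map endpoints pieces ≡ Cedges
  pieces-endpoints = layout-endpoints nothing segments₂ segments₁ lastP lastQ

  start₁ : Maybe O₁ → ℕ
  start₁ nothing  = 0
  start₁ (just o) = suc (idx o)

  end₂ : Maybe I₂ → ℕ
  end₂ nothing  = length (edges G₂)
  end₂ (just i) = idx i

  rank₁ rank₂ : Piece → ℕ
  rank₁ (kept₁ _  e) = at (idx e)
  rank₁ (glued o _)  = at (idx o)
  rank₁ (kept₂ mo _) = before (start₁ mo)
  rank₂ (kept₂ _  e) = at (idx e)
  rank₂ (glued _ i)  = at (idx i)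
  rank₂ (kept₁ mi _) = before (end₂ mi)

  tailPieces-ascending₁ : ∀ mo t₂ t₁ → StrictlyBetween idx (start₁ mo) t₁ (length (edges G₁)) →
                          AscendingFrom rank₁ (before (start₁ mo)) (tailPieces mo t₂ t₁)
  tailPieces-ascending₁ mo t₂ t₁ between =
    ascending-constant-block rank₁ (kept₂ mo) (λ _ → refl) ≤-refl t₂
      (subst (AscendingFrom rank₁ _) (++-identityʳ _)
        (ascending-strict-block idx rank₁ (kept₁ nothing) (λ _ → refl) t₁ between ≤-refl tt))

  layout-ascending₁ : ∀ mo segs₂ segs₁ t₂ t₁ → SplitBetween isOut₁ (start₁ mo) segs₁ t₁ →
                      AscendingFrom rank₁ (before (start₁ mo)) (layout mo segs₂ segs₁ t₂ t₁)
  layout-ascending₁ mo []      segs₁ t₂ t₁ split =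
    tailPieces-ascending₁ mo t₂ t₁ (splitBetween-tail isOut₁ segs₁ t₁ split)
  layout-ascending₁ mo (_ ∷ _) []    t₂ t₁ split = tailPieces-ascending₁ mo t₂ t₁ split
  layout-ascending₁ mo ((P , i) ∷ segs₂) ((Q , o) ∷ segs₁) t₂ t₁ (between , split) =
    ascending-constant-block rank₁ (kept₂ mo) (λ _ → refl) ≤-refl P
      (ascending-strict-block idx rank₁ (kept₁ (just i)) (λ _ → refl) Q between ≤-refl
        (before≤at (idx o) ,
         ascending-weaken rank₁ _ (at≤before-suc (idx o))
           (layout-ascending₁ (just o) segs₂ segs₁ t₂ t₁ split)))

  tailPieces-ascending₂ : ∀ mo t₂ t₁ {lb} → StrictlyBetween idx lb t₂ (length (edges G₂)) →
                          AscendingFrom rank₂ (before lb) (tailPieces mo t₂ t₁)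
  tailPieces-ascending₂ mo t₂ t₁ between =
    ascending-strict-block idx rank₂ (kept₂ mo) (λ _ → refl) t₂ between ≤-refl
      (subst (AscendingFrom rank₂ _) (++-identityʳ _)
        (ascending-constant-block rank₂ (kept₁ nothing) (λ _ → refl) ≤-refl t₁ tt))

  layout-ascending₂ : ∀ mo segs₂ segs₁ t₂ t₁ {lb} → SplitBetween isIn₂ lb segs₂ t₂ →
                      AscendingFrom rank₂ (before lb) (layout mo segs₂ segs₁ t₂ t₁)
  layout-ascending₂ mo []    segs₁ t₂ t₁ split = tailPieces-ascending₂ mo t₂ t₁ split
  layout-ascending₂ mo segs₂@(_ ∷ _) [] t₂ t₁ split =
    tailPieces-ascending₂ mo t₂ t₁ (splitBetween-tail isIn₂ segs₂ t₂ split)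
  layout-ascending₂ mo ((P , i) ∷ segs₂) ((Q , o) ∷ segs₁) t₂ t₁ (between , split) =
    ascending-strict-block idx rank₂ (kept₂ mo) (λ _ → refl) P between ≤-refl
      (ascending-constant-block rank₂ (kept₁ (just i)) (λ _ → refl) ≤-refl Q
        (before≤at (idx i) ,
         ascending-weaken rank₂ _ (at≤before-suc (idx i))
           (layout-ascending₂ (just o) segs₂ segs₁ t₂ t₁ split)))

  pieces-ascending₁ : AscendingFrom rank₁ 0 pieces
  pieces-ascending₁ = layout-ascending₁ nothing segments₂ segments₁ lastP lastQ
    (splitBy-between isOut₁ (allFin _) (allFin-strictlyBetween _))

  pieces-ascending₂ : AscendingFrom rank₂ 0 pieces
  pieces-ascending₂ = layout-ascending₂ nothing segments₂ segments₁ lastP lastQ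
    (splitBy-between isIn₂ (allFin _) (allFin-strictlyBetween _))

  _⊑_ : Piece → Piece → Set
  t ⊑ t′ = rank₁ t ≤ rank₁ t′ × rank₂ t ≤ rank₂ t′

  source-in-G₁ : ∀ t {u nu} → source t ≡ inj₁ (u , nu) →
                 Σ (Edge G₁) λ x → src G₁ x ≡ u × rank₁ t ≡ at (toℕ x)
  source-in-G₁ (kept₁ _ (x , _)) refl = x , refl , refl
  source-in-G₁ (glued (x , _) _) refl = x , refl , refl
  source-in-G₁ (kept₂ _ _)       ()

  source-in-G₂ : ∀ t {w nw} → source t ≡ inj₂ (w , nw) →
                 Σ (Edge G₂) λ x → src G₂ x ≡ w × rank₂ t ≡ at (toℕ x)
  source-in-G₂ (kept₂ _ (x , _)) refl = x , refl , refl
  source-in-G₂ (kept₁ _ _)       ()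
  source-in-G₂ (glued _ _)       ()

  target-in-G₁ : ∀ t {u nu} → target t ≡ inj₁ (u , nu) →
                 Σ (Edge G₁) λ x → tgt G₁ x ≡ u × rank₁ t ≡ at (toℕ x)
  target-in-G₁ (kept₁ _ (x , _)) refl = x , refl , refl
  target-in-G₁ (kept₂ _ _)       ()
  target-in-G₁ (glued _ _)       ()

  target-in-G₂ : ∀ t {w nw} → target t ≡ inj₂ (w , nw) →
                 Σ (Edge G₂) λ x → tgt G₂ x ≡ w × rank₂ t ≡ at (toℕ x)
  target-in-G₂ (kept₂ _ (x , _)) refl = x , refl , refl
  target-in-G₂ (glued _ (x , _)) refl = x , refl , refl
  target-in-G₂ (kept₁ _ _)       ()

  input-in-G₁ : ∀ t → T (Cσ (source t)) →
                Σ (Edge G₁) λ x → InputEdge G₁ x × rank₁ t ≡ at (toℕ x)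
  input-in-G₁ (kept₁ _ (x , _))  input = x , input , refl
  input-in-G₁ (glued (x , _) _)  input = x , input , refl
  input-in-G₁ (kept₂ _ (x , nx)) input = ⊥-elim (nx input)

  input-in-G₂ : ∀ t → T (Cσ (source t)) →
                rank₂ t ≡ before (length (edges G₂)) ⊎
                Σ (Edge G₂) λ x → InputEdge G₂ x × before (toℕ x) ≤ rank₂ t × rank₂ t ≤ at (toℕ x)
  input-in-G₂ (kept₁ nothing _)         _     = inj₁ refl
  input-in-G₂ (kept₁ (just (x , ix)) _) _     = inj₂ (x , ix , ≤-refl , before≤at (toℕ x))
  input-in-G₂ (glued _ (x , ix))        _     = inj₂ (x , ix , before≤at (toℕ x) , ≤-refl)
  input-in-G₂ (kept₂ _ (x , nx))        input = ⊥-elim (nx input)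

  output-in-G₁ : ∀ t → T (Cσ (target t)) →
                 rank₁ t ≡ 0 ⊎
                 Σ (Edge G₁) λ x →
                   OutputEdge G₁ x × at (toℕ x) ≤ rank₁ t × rank₁ t ≤ before (suc (toℕ x))
  output-in-G₁ (kept₂ nothing _)         _      = inj₁ refl
  output-in-G₁ (kept₂ (just (x , ox)) _) _      = inj₂ (x , ox , at≤before-suc (toℕ x) , ≤-refl)
  output-in-G₁ (glued (x , ox) _)        _      = inj₂ (x , ox , ≤-refl , at≤before-suc (toℕ x))
  output-in-G₁ (kept₁ _ (x , nx))        output = ⊥-elim (nx output)

  output-in-G₂ : ∀ t → T (Cσ (target t)) →
                 Σ (Edge G₂) λ x → OutputEdge G₂ x × rank₂ t ≡ at (toℕ x)
  output-in-G₂ (kept₂ _ (x , _))  output = x , output , refl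
  output-in-G₂ (glued _ (x , _))  output = x , output , refl
  output-in-G₂ (kept₁ _ (x , nx)) output = ⊥-elim (nx output)

  module _ (adm₁ : AdmissibleCond G₁) (adm₂ : AdmissibleCond G₂) where

    sources-separated : ∀ v → ¬ T (Cσ v) → ∀ {ta te tb} → source ta ≡ v → source tb ≡ v →
                        T (Cσ (source te)) → ta ⊑ te → te ⊑ tb → ⊥
    sources-separated (inj₁ (u , _)) inner {ta} {te} {tb} a-v b-v input (a≤e , _) (e≤b , _)
      with source-in-G₁ ta a-v | source-in-G₁ tb b-v | input-in-G₁ te input
    ... | a , a-out , ra | b , b-out , rb | x , x-in , rx =
      proj₁ (adm₁ u inner) x x-in
        (a , b , a-out , b-out , at≤at⇒≤ (subst₂ _≤_ ra rx a≤e) , at≤at⇒≤ (subst₂ _≤_ rx rb e≤b))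
    sources-separated (inj₂ (w , _)) inner {ta} {te} {tb} a-v b-v input (_ , a≤e) (_ , e≤b)
      with source-in-G₂ ta a-v | source-in-G₂ tb b-v | input-in-G₂ te input
    ... | _ , _ , _ | b , _ , rb | inj₁ re =
      ≤⇒≯ (before≤at⇒≤ (subst₂ _≤_ re rb e≤b)) (toℕ<n b)
    ... | a , a-out , ra | b , b-out , rb | inj₂ (x , x-in , x≤e , e≤x) =
      proj₁ (adm₂ w inner) x x-in
        (a , b , a-out , b-out ,
         at≤at⇒≤ (≤-trans (subst (_≤ _) ra a≤e) e≤x) ,
         before≤at⇒≤ (≤-trans x≤e (subst (_ ≤_) rb e≤b)))

    targets-separated : ∀ v → ¬ T (Cσ v) → ∀ {ta te tb} → target ta ≡ v → target tb ≡ v →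
                        T (Cσ (target te)) → ta ⊑ te → te ⊑ tb → ⊥
    targets-separated (inj₁ (u , _)) inner {ta} {te} {tb} a-v b-v output (a≤e , _) (e≤b , _)
      with target-in-G₁ ta a-v | target-in-G₁ tb b-v | output-in-G₁ te output
    ... | a , _ , ra | _ | inj₁ re = n≮0 (subst₂ _≤_ ra re a≤e)
    ... | a , a-in , ra | b , b-in , rb | inj₂ (x , x-out , x≤e , e≤x) =
      proj₂ (adm₁ u inner) x x-out
        (a , b , a-in , b-in ,
         s≤s⁻¹ (at≤before⇒< (≤-trans (subst (_≤ _) ra a≤e) e≤x)) ,
         at≤at⇒≤ (≤-trans x≤e (subst (_ ≤_) rb e≤b)))
    targets-separated (inj₂ (w , _)) inner {ta} {te} {tb} a-v b-v output (_ , a≤e) (_ , e≤b)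
      with target-in-G₂ ta a-v | target-in-G₂ tb b-v | output-in-G₂ te output
    ... | a , a-in , ra | b , b-in , rb | x , x-out , rx =
      proj₂ (adm₂ w inner) x x-out
        (a , b , a-in , b-in , at≤at⇒≤ (subst₂ _≤_ ra rx a≤e) , at≤at⇒≤ (subst₂ _≤_ rx rb e≤b))

  graphOf : List (CV × CV) → PGraph
  graphOf es = record { V = CV ; edges = es ; σ = Cσ }

  module _ (ps : List Piece) where

    private
      G : PGraph
      G = graphOf (map endpoints ps)

    origin : Edge G → Piece
    origin e = lookup ps (cast (length-map endpoints ps) e)

    source-origin : ∀ e → src G e ≡ source (origin e)
    source-origin e = cong proj₁ (lookup-map endpoints ps e)

    target-origin : ∀ e → tgt G e ≡ target (origin e)
    target-origin e = cong proj₂ (lookup-map endpoints ps e)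

    origin-mono : AscendingFrom rank₁ 0 ps → AscendingFrom rank₂ 0 ps →
                  ∀ {e e′} → toℕ e ≤ toℕ e′ → origin e ⊑ origin e′
    origin-mono asc₁ asc₂ {e} {e′} e≤e′ =
      ascending-lookup rank₁ ps asc₁ cast-e≤e′ , ascending-lookup rank₂ ps asc₂ cast-e≤e′
      where
      cast-e≤e′ : toℕ (cast (length-map endpoints ps) e) ≤ toℕ (cast (length-map endpoints ps) e′)
      cast-e≤e′ = subst₂ _≤_ (sym (toℕ-cast _ e)) (sym (toℕ-cast _ e′)) e≤e′

    pieces-admissible : AdmissibleCond G₁ → AdmissibleCond G₂ →
                        AscendingFrom rank₁ 0 ps → AscendingFrom rank₂ 0 ps → AdmissibleCond G
    pieces-admissible adm₁ adm₂ asc₁ asc₂ v inner =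
      (λ e input (a , b , a-v , b-v , a≤e , e≤b) →
        sources-separated adm₁ adm₂ v inner {origin a} {origin e} {origin b}
          (trans (sym (source-origin a)) a-v) (trans (sym (source-origin b)) b-v)
          (subst (T ∘ Cσ) (source-origin e) input) (mono a≤e) (mono e≤b)) ,
      (λ e output (a , b , a-v , b-v , a≤e , e≤b) →
        targets-separated adm₁ adm₂ v inner {origin a} {origin e} {origin b}
          (trans (sym (target-origin a)) a-v) (trans (sym (target-origin b)) b-v)
          (subst (T ∘ Cσ) (target-origin e) output) (mono a≤e) (mono e≤b))
      where
      mono : ∀ {e e′ : Edge G} → toℕ e ≤ toℕ e′ → origin e ⊑ origin e′
      mono = origin-mono asc₁ asc₂

proposition5p2 : (G₁ G₂ : PGraph) (n : ℕ) →
    FiniteV G₁ → IsProgressive G₁ → IsUPO G₁ → AdmissibleCond G₁ →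
    FiniteV G₂ → IsProgressive G₂ → IsUPO G₂ → AdmissibleCond G₂ →
    (h₁ : numOutputEdges G₁ ≡ n) → (h₂ : numInputEdges G₂ ≡ n) →
    AdmissibleCond (compose G₁ G₂ (trans h₁ (sym h₂)))
proposition5p2 G₁ G₂ _ _ _ _ adm₁ _ _ _ adm₂ _ _ =
  subst (AdmissibleCond ∘ graphOf) pieces-endpoints
    (pieces-admissible pieces adm₁ adm₂ pieces-ascending₁ pieces-ascending₂)
  where open Pieces G₁ G₂
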